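{- Let $\mathcal{C}$ be a finite set of $k$-connected finite graphs. Let $G\in\mathcal{E}_{\mathcal{C}}$ and $A\subseteq V(G)$ with $|A|<k$. Then $\mathrm{acl}_G(A)=A$.
   Context: All graphs are simple. A graph omits $\mathcal{C}$ if no subgraph (not necessarily induced) is isomorphic to a member of $\mathcal{C}$; $\mathcal{G}_{\mathcal{C}}$ is the class of countable graphs omitting $\mathcal{C}$; $G\in\mathcal{G}_{\mathcal{C}}$ is existentially complete if for every $H\in\mathcal{G}_{\mathcal{C}}$ containing $G$ as induced subgraph, every existential first-order formula (language of adjacency) with parameters from $G$ true in $H$ is true in $G$; $\mathcal{E}_{\mathcal{C}}$ is the class of these. $\mathrm{acl}_G(A)$ is the set of vertices $a$ such that some existential formula $\phi(x,\bar a)$ with parameters from $A$ has a finite solution set in $G$ containing $a$. -}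

module Defs where

open import Data.Nat using (ℕ; zero; suc; _<_)
open import Data.Fin using (Fin; zero; suc)
open import Data.Bool using (Bool; T)
open import Data.List using (List; length)
open import Data.List.Membership.Propositional using (_∈_; _∉_)
open import Data.List.Relation.Unary.All using (All)
open import Data.Product using (Σ; ∃; _×_; _,_; proj₁)
open import Data.Sum using (_⊎_)
open import Data.Empty using (⊥)
open import Data.Unit using (⊤)
open import Relation.Nullary using (¬_)
open import Relation.Binary.PropositionalEquality using (_≡_)
open import Function.Definitions using (Injective)
open import Function.Bundles using (_⇔_)

record FinGraph : Set where
  field
    size   : ℕ
    adj    : Fin size → Fin size → Bool
    sym    : ∀ u v → T (adj u v) → T (adj v u)
    irrefl : ∀ u → ¬ T (adj u u)

-- Reachability in a finite graph through vertices satisfying `ok`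
-- (the start vertex u is assumed ok by the caller).
data Reach (F : FinGraph) (ok : Fin (FinGraph.size F) → Set)
  : Fin (FinGraph.size F) → Fin (FinGraph.size F) → Set where
  here : ∀ {u} → Reach F ok u u
  step : ∀ {u w v} → T (FinGraph.adj F u w) → ok w → Reach F ok w v → Reach F ok u v

KConnected : ℕ → FinGraph → Set
KConnected k F =
  (k < FinGraph.size F) ×
  ((X : List (Fin (FinGraph.size F))) → length X < k →
     ∀ u v → u ∉ X → v ∉ X → Reach F (λ w → w ∉ X) u v)

record Graph : Set₁ where
  field
    V      : Set
    Adj    : V → V → Set
    sym    : ∀ {u v} → Adj u v → Adj v u
    irrefl : ∀ {u} → ¬ Adj u u
    code   : V → ℕ               -- countability: injection into ℕ
    code-inj : Injective _≡_ _≡_ code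

open Graph public

SubgraphOf : FinGraph → Graph → Set
SubgraphOf F H =
  Σ (Fin (FinGraph.size F) → V H) λ f →
    Injective _≡_ _≡_ f × (∀ u v → T (FinGraph.adj F u v) → Adj H (f u) (f v))

Omits : List FinGraph → Graph → Set
Omits C H = All (λ F → ¬ SubgraphOf F H) C

InducedEmbedding : Graph → Graph → Set
InducedEmbedding G H =
  Σ (V G → V H) λ f →
    Injective _≡_ _≡_ f × (∀ u v → Adj G u v ⇔ Adj H (f u) (f v))

data QF (n : ℕ) : Set where
  adjF : Fin n → Fin n → QF n
  eqF  : Fin n → Fin n → QF n
  ⊤F ⊥F : QF n
  ¬F   : QF n → QF n
  _∧F_ _∨F_ : QF n → QF n → QF n

data ExF (n : ℕ) : Set where
  qf : QF n → ExF n
  ∃F : ExF (suc n) → ExF n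

extend : {A : Set} {n : ℕ} → A → (Fin n → A) → Fin (suc n) → A
extend a e zero    = a
extend a e (suc i) = e i

SatQF : (G : Graph) {n : ℕ} → (Fin n → V G) → QF n → Set
SatQF G e (adjF i j) = Adj G (e i) (e j)
SatQF G e (eqF i j)  = e i ≡ e j
SatQF G e ⊤F         = ⊤
SatQF G e ⊥F         = ⊥
SatQF G e (¬F φ)     = ¬ SatQF G e φ
SatQF G e (φ ∧F ψ)   = SatQF G e φ × SatQF G e ψ
SatQF G e (φ ∨F ψ)   = SatQF G e φ ⊎ SatQF G e ψ

Sat : (G : Graph) {n : ℕ} → (Fin n → V G) → ExF n → Set
Sat G e (qf φ) = SatQF G e φ
Sat G e (∃F φ) = Σ (V G) λ a → Sat G (extend a e) φ

InGC : List FinGraph → Graph → Set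
InGC C G = Omits C G

ExistentiallyComplete : List FinGraph → Graph → Set₁
ExistentiallyComplete C G =
  InGC C G ×
  ((H : Graph) → InGC C H → (emb : InducedEmbedding G H) →
     ∀ {n} (φ : ExF n) (e : Fin n → V G) →
       Sat H (λ i → proj₁ emb (e i)) φ → Sat G e φ)

InAcl : (G : Graph) → List (V G) → V G → Set
InAcl G A a =
  Σ ℕ λ n → Σ (ExF (suc n)) λ φ → Σ (Fin n → V G) λ ps →
    (∀ i → ps i ∈ A) ×
    (Σ (List (V G)) λ L → ∀ b → Sat G (extend b ps) φ → b ∈ L) ×
    Sat G (extend a ps) φ

-- Suppose a ∉ A and glue two copies of G along A. The amalgam H still omits C:
-- A separates the two copies and |A| < k, so a k-connected subgraph of H lies
-- in one copy together with A and projects injectively into G. G embeds into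
-- H over A in two ways, and the second embedding sends a outside the first
-- copy. So if φ(a, ā) holds in G, then for every finite list L the statement
-- "φ(x, ā) has a solution outside L" holds in H, hence in G by existential
-- completeness: no finite list covers the solutions of φ(x, ā).
module Submission where

open import Defs hiding (sym; irrefl)
open import Data.Nat using (ℕ; _<_)
open import Data.List using (List; length)
open import Data.List.Membership.Propositional using (_∈_)
open import Data.List.Relation.Unary.All using (All)
open import Function.Bundles using (_⇔_)

open import Data.Nat using (zero; suc; _+_; _*_; _≤_; z≤n; s≤s) renaming (_≟_ to _≟ℕ_)
open import Data.Nat.Properties
  using (≤-trans; ≤-<-trans; m≤n⇒m≤1+n; *-cancelˡ-≡; even≢odd; suc-injective)
open import Data.Fin using (Fin; zero; suc; lift; _↑ˡ_; _↑ʳ_)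
open import Data.Fin.Properties using (any?)
open import Data.Vec.Functional using (_++_)
open import Data.Vec.Functional.Properties using (lookup-++ˡ; lookup-++ʳ)
open import Data.List using ([]; _∷_; map; lookup)
open import Data.List.Properties using (length-map)
open import Data.List.Membership.Propositional using (_∉_)
open import Data.List.Membership.Propositional.Properties using (∈-map⁺; ∈-map⁻)
open import Data.List.Relation.Unary.All using (zipWith)
open import Data.List.Relation.Unary.Any as Any using (here; there)
open import Data.List.Relation.Unary.Any.Properties using (lookup-index)
open import Data.Bool using (T)
open import Data.Product using (∃-syntax; _×_; _,_; proj₁)
open import Data.Product.Function.NonDependent.Propositional using (_×-⇔_)
open import Data.Sum using (_⊎_; inj₁; inj₂; [_,_]′; reduce)
open import Data.Sum.Function.Propositional using (_⊎-⇔_)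
open import Data.Sum.Properties using (inj₁-injective)
open import Data.Empty using (⊥)
open import Data.Unit using (tt)
open import Relation.Nullary using (¬_; Dec; yes; no; contradiction)
open import Relation.Nullary.Decidable using (decidable-stable)
open import Relation.Binary.PropositionalEquality
  using (_≡_; _≢_; refl; sym; trans; cong; cong₂; subst)
open import Relation.Binary.Definitions using (DecidableEquality)
open import Function using (id; _∘_)
open import Function.Bundles using (mk⇔; Equivalence)
open import Function.Definitions using (Injective)
open import Function.Construct.Identity using (⇔-id)
open import Function.Construct.Symmetry using (⇔-sym)
open import Function.Related.TypeIsomorphisms using (¬-cong-⇔)

open Equivalence using (to; from)

renameQF : ∀ {m n} → (Fin m → Fin n) → QF m → QF n
renameQF ρ (adjF i j) = adjF (ρ i) (ρ j)
renameQF ρ (eqF i j)  = eqF (ρ i) (ρ j)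
renameQF ρ ⊤F         = ⊤F
renameQF ρ ⊥F         = ⊥F
renameQF ρ (¬F χ)     = ¬F (renameQF ρ χ)
renameQF ρ (χ ∧F ψ)   = renameQF ρ χ ∧F renameQF ρ ψ
renameQF ρ (χ ∨F ψ)   = renameQF ρ χ ∨F renameQF ρ ψ

renameEx : ∀ {m n} → (Fin m → Fin n) → ExF m → ExF n
renameEx ρ (qf χ) = qf (renameQF ρ χ)
renameEx ρ (∃F φ) = ∃F (renameEx (lift 1 ρ) φ)

_∧∃_ : ∀ {n} → ExF n → QF n → ExF n
qf ψ ∧∃ χ = qf (ψ ∧F χ)
∃F φ ∧∃ χ = ∃F (φ ∧∃ renameQF suc χ)

⋀ : ∀ {m n} → (Fin m → QF n) → QF n
⋀ {zero}  χs = ⊤F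
⋀ {suc m} χs = χs zero ∧F ⋀ (χs ∘ suc)

-- ∃x. φ(x, p̄) ∧ x ≠ l₁ ∧ … ∧ x ≠ lₘ, with the parameters l̄ followed by p̄.
avoiding : ∀ m {n} → ExF (suc n) → ExF (m + n)
avoiding m {n} φ =
  ∃F (renameEx (lift 1 (m ↑ʳ_)) φ ∧∃ ⋀ (λ j → ¬F (eqF zero (suc (j ↑ˡ n)))))

id-embedding : (K : Graph) → InducedEmbedding K K
id-embedding K = id , id , λ _ _ → ⇔-id _

SatQF-rename : ∀ (K : Graph) {m n} (ρ : Fin m → Fin n) (e : Fin n → V K) χ →
               SatQF K e (renameQF ρ χ) ≡ SatQF K (e ∘ ρ) χ
SatQF-rename K ρ e (adjF i j) = refl
SatQF-rename K ρ e (eqF i j)  = refl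
SatQF-rename K ρ e ⊤F         = refl
SatQF-rename K ρ e ⊥F         = refl
SatQF-rename K ρ e (¬F χ)     = cong ¬_ (SatQF-rename K ρ e χ)
SatQF-rename K ρ e (χ ∧F ψ)   = cong₂ _×_ (SatQF-rename K ρ e χ) (SatQF-rename K ρ e ψ)
SatQF-rename K ρ e (χ ∨F ψ)   = cong₂ _⊎_ (SatQF-rename K ρ e χ) (SatQF-rename K ρ e ψ)

SatQF-embed : ∀ {G H : Graph} {n} (emb : InducedEmbedding G H)
              {e : Fin n → V G} {e′ : Fin n → V H} →
              (∀ i → e′ i ≡ proj₁ emb (e i)) → ∀ χ → SatQF H e′ χ ⇔ SatQF G e χ
SatQF-embed (_ , _ , f-adj) e′≗fe (adjF i j)
  rewrite e′≗fe i | e′≗fe j = ⇔-sym (f-adj _ _)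
SatQF-embed (f , f-inj , _) e′≗fe (eqF i j)
  rewrite e′≗fe i | e′≗fe j = mk⇔ f-inj (cong f)
SatQF-embed emb e′≗fe ⊤F       = ⇔-id _
SatQF-embed emb e′≗fe ⊥F       = ⇔-id _
SatQF-embed emb e′≗fe (¬F χ)   = ¬-cong-⇔ (SatQF-embed emb e′≗fe χ)
SatQF-embed emb e′≗fe (χ ∧F ψ) = SatQF-embed emb e′≗fe χ ×-⇔ SatQF-embed emb e′≗fe ψ
SatQF-embed emb e′≗fe (χ ∨F ψ) = SatQF-embed emb e′≗fe χ ⊎-⇔ SatQF-embed emb e′≗fe ψ

Sat-embed : ∀ {G H : Graph} {n} (emb : InducedEmbedding G H)
            {e : Fin n → V G} {e′ : Fin n → V H} →
            (∀ i → e′ i ≡ proj₁ emb (e i)) → ∀ φ → Sat G e φ → Sat H e′ φ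
Sat-embed emb e′≗fe (qf χ)         = from (SatQF-embed emb e′≗fe χ)
Sat-embed emb {e} {e′} e′≗fe (∃F φ) (a , s) =
  proj₁ emb a , Sat-embed emb extend-≗ φ s
  where
  extend-≗ : ∀ i → extend (proj₁ emb a) e′ i ≡ proj₁ emb (extend a e i)
  extend-≗ zero    = refl
  extend-≗ (suc i) = e′≗fe i

Sat-rename : ∀ {K : Graph} {m n} {ρ : Fin m → Fin n} {e : Fin m → V K} {e′ : Fin n → V K} →
             (∀ i → e′ (ρ i) ≡ e i) → ∀ φ → Sat K e′ (renameEx ρ φ) ⇔ Sat K e φ
Sat-rename {K} {ρ = ρ} {e} {e′} e′ρ≗e (qf χ) =
  subst (_⇔ SatQF K e χ) (sym (SatQF-rename K ρ e′ χ))
        (SatQF-embed (id-embedding K) e′ρ≗e χ)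
Sat-rename {ρ = ρ} {e} {e′} e′ρ≗e (∃F φ) =
  mk⇔ (λ (a , s) → a , to (IH a) s) (λ (a , s) → a , from (IH a) s)
  where
  IH : ∀ a → Sat _ (extend a e′) (renameEx (lift 1 ρ) φ) ⇔ Sat _ (extend a e) φ
  IH a = Sat-rename extend-lift φ
    where
    extend-lift : ∀ i → extend a e′ (lift 1 ρ i) ≡ extend a e i
    extend-lift zero    = refl
    extend-lift (suc i) = e′ρ≗e i

Sat-∧∃ : ∀ {K : Graph} {n} {e : Fin n → V K} φ χ →
         Sat K e (φ ∧∃ χ) ⇔ (Sat K e φ × SatQF K e χ)
Sat-∧∃ (qf ψ) χ = ⇔-id _
Sat-∧∃ {K} {e = e} (∃F φ) χ = mk⇔
  (λ (a , s) → let (s₁ , t) = to (IH a) s in (a , s₁) , subst id (SatQF-rename K suc _ χ) t)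
  (λ ((a , s₁) , t) → a , from (IH a) (s₁ , subst id (sym (SatQF-rename K suc _ χ)) t))
  where
  IH : ∀ a → Sat K (extend a e) (φ ∧∃ renameQF suc χ) ⇔
             (Sat K (extend a e) φ × SatQF K (extend a e) (renameQF suc χ))
  IH a = Sat-∧∃ φ (renameQF suc χ)

SatQF-⋀ : ∀ {K : Graph} {m n} {e : Fin n → V K} (χs : Fin m → QF n) →
          SatQF K e (⋀ χs) ⇔ (∀ j → SatQF K e (χs j))
SatQF-⋀ {m = zero}  χs = mk⇔ (λ _ ()) (λ _ → tt)
SatQF-⋀ {m = suc m} χs = mk⇔
  (λ (s , t) → λ { zero → s ; (suc j) → to (SatQF-⋀ (χs ∘ suc)) t j })
  (λ s → s zero , from (SatQF-⋀ (χs ∘ suc)) (s ∘ suc))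

Sat-avoiding : ∀ {K : Graph} {m n} (φ : ExF (suc n)) (E : Fin (m + n) → V K)
               (L : Fin m → V K) (ps : Fin n → V K) →
               (∀ j → E (j ↑ˡ n) ≡ L j) → (∀ i → E (m ↑ʳ i) ≡ ps i) →
               Sat K E (avoiding m φ) ⇔ (∃[ c ] (∀ j → c ≢ L j) × Sat K (extend c ps) φ)
Sat-avoiding {K} {m} {n} φ E L ps E≗L E≗ps = mk⇔
  (λ (c , s) → let (s₁ , t) = to (Sat-∧∃ ψ χ) s in
               c , to (distinct c) (to (SatQF-⋀ ≢E) t) , to (body c) s₁)
  (λ (c , c≢L , s) → c , from (Sat-∧∃ ψ χ)
               (from (body c) s , from (SatQF-⋀ ≢E) (from (distinct c) c≢L)))
  where
  ψ : ExF (suc (m + n))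
  ψ = renameEx (lift 1 (m ↑ʳ_)) φ
  ≢E : Fin m → QF (suc (m + n))
  ≢E j = ¬F (eqF zero (suc (j ↑ˡ n)))
  χ : QF (suc (m + n))
  χ = ⋀ ≢E
  body : ∀ c → Sat K (extend c E) ψ ⇔ Sat K (extend c ps) φ
  body c = Sat-rename extend-↑ʳ φ
    where
    extend-↑ʳ : ∀ i → extend c E (lift 1 (m ↑ʳ_) i) ≡ extend c ps i
    extend-↑ʳ zero    = refl
    extend-↑ʳ (suc i) = E≗ps i
  distinct : ∀ c → (∀ j → c ≢ E (j ↑ˡ n)) ⇔ (∀ j → c ≢ L j)
  distinct c = mk⇔ (λ c≢E j → subst (c ≢_) (E≗L j) (c≢E j))
                   (λ c≢L j → subst (c ≢_) (sym (E≗L j)) (c≢L j))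

ExistentiallyComplete-avoids :
  ∀ {C G} → ExistentiallyComplete C G →
  (H : Graph) → InGC C H → (emb : InducedEmbedding G H) →
  ∀ {m n} (φ : ExF (suc n)) (ps : Fin n → V G) (L : Fin m → V G) {b : V H} →
  (∀ j → b ≢ proj₁ emb (L j)) → Sat H (extend b (proj₁ emb ∘ ps)) φ →
  ∃[ c ] (∀ j → c ≢ L j) × Sat G (extend c ps) φ
ExistentiallyComplete-avoids (_ , ec) H H∈GC emb@(f , _) {m} φ ps L {b} b≢L sat =
  to (Sat-avoiding φ (L ++ ps) L ps (lookup-++ˡ L ps) (lookup-++ʳ L ps))
     (ec H H∈GC emb (avoiding m φ) (L ++ ps)
        (from (Sat-avoiding φ (f ∘ (L ++ ps)) (f ∘ L) (f ∘ ps)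
                            (cong f ∘ lookup-++ˡ L ps) (cong f ∘ lookup-++ʳ L ps))
              (b , b≢L , sat)))

≟-vertex : (G : Graph) → DecidableEquality (V G)
≟-vertex G u v with code G u ≟ℕ code G v
... | yes cu≡cv = yes (code-inj G cu≡cv)
... | no  cu≢cv = no (cu≢cv ∘ cong (code G))

module _ {B : Set} (_≟_ : DecidableEquality B) where

  preimages : ∀ {n} → (Fin n → B) → List B → List (Fin n)
  preimages h [] = []
  preimages h (b ∷ bs) with any? (λ w → h w ≟ b)
  ... | yes (w , _) = w ∷ preimages h bs
  ... | no _        = preimages h bs

  length-preimages : ∀ {n} (h : Fin n → B) bs → length (preimages h bs) ≤ length bs
  length-preimages h [] = z≤n
  length-preimages h (b ∷ bs) with any? (λ w → h w ≟ b)
  ... | yes _ = s≤s (length-preimages h bs)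
  ... | no _  = m≤n⇒m≤1+n (length-preimages h bs)

  ∈-preimages⁻ : ∀ {n} (h : Fin n → B) bs {w} → w ∈ preimages h bs → h w ∈ bs
  ∈-preimages⁻ h (b ∷ bs) w∈ with any? (λ w → h w ≟ b)
  ∈-preimages⁻ h (b ∷ bs) (here refl) | yes (_ , hw≡b) = here hw≡b
  ∈-preimages⁻ h (b ∷ bs) (there w∈) | yes _ = there (∈-preimages⁻ h bs w∈)
  ∈-preimages⁻ h (b ∷ bs) w∈          | no _  = there (∈-preimages⁻ h bs w∈)

  ∈-preimages⁺ : ∀ {n} {h : Fin n → B} → Injective _≡_ _≡_ h →
                 ∀ bs {w} → h w ∈ bs → w ∈ preimages h bs
  ∈-preimages⁺ {h = h} h-inj (b ∷ bs) {w} hw∈ with any? (λ v → h v ≟ b) | hw∈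
  ... | yes (v , hv≡b) | here hw≡b = here (h-inj (trans hw≡b (sym hv≡b)))
  ... | yes _          | there hw∈ = there (∈-preimages⁺ h-inj bs hw∈)
  ... | no ∄v          | here hw≡b = contradiction (w , hw≡b) ∄v
  ... | no _           | there hw∈ = ∈-preimages⁺ h-inj bs hw∈

another : ∀ {n} → 2 ≤ n → (v : Fin n) → ∃[ w ] v ≢ w
another {suc (suc n)} _ zero    = suc zero , λ ()
another {suc (suc n)} _ (suc v) = zero , λ ()
another {suc zero} (s≤s ()) zero

Reach-preserves : ∀ {F ok} (P : Fin (FinGraph.size F) → Set) →
                  (∀ {u w} → T (FinGraph.adj F u w) → ok w → P u → P w) →
                  ∀ {u v} → Reach F ok u v → P u → P v
Reach-preserves P P-step here          Pu = Pu
Reach-preserves P P-step (step uw ok r) Pu = Reach-preserves P P-step r (P-step uw ok Pu)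

KConnected-neighbour : ∀ {k F} → KConnected k F → 0 < k →
                       ∀ u → ∃[ w ] T (FinGraph.adj F u w)
KConnected-neighbour {F = F} (k<size , connected) 0<k u
  with another (≤-trans (s≤s 0<k) k<size) u
... | w , u≢w = first-step (connected [] 0<k u w (λ ()) (λ ())) u≢w
  where
  first-step : ∀ {ok v} → Reach F ok u v → u ≢ v → ∃[ w ] T (FinGraph.adj F u w)
  first-step here         u≢u = contradiction refl u≢u
  first-step (step uw _ _) _  = _ , uw

SeparatedBy : (H : Graph) → List (V H) → (V H → Set) → Set
SeparatedBy H S P = ∀ x y → Adj H x y → P x → y ∈ S ⊎ P y

-- The vertices of F sent into S form a set X with |X| < k, and F - X is connected.
KConnected-one-side : ∀ {k F H} → KConnected k F → (emb : SubgraphOf F H) →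
                      ∀ S {P} → length S < k → SeparatedBy H S P →
                      ∀ u w → proj₁ emb u ∉ S → proj₁ emb w ∉ S →
                      P (proj₁ emb u) → P (proj₁ emb w)
KConnected-one-side {F = F} {H} (_ , connected) (h , h-inj , h-adj) S {P}
                    |S|<k separated u w hu∉S hw∉S =
  Reach-preserves (P ∘ h) P-step
    (connected X |X|<k u w (hu∉S ∘ ∈-preimages⁻ _≟_ h S) (hw∉S ∘ ∈-preimages⁻ _≟_ h S))
  where
  _≟_ : DecidableEquality (V H)
  _≟_ = ≟-vertex H
  X : List (Fin (FinGraph.size F))
  X = preimages _≟_ h S
  |X|<k : length X < _
  |X|<k = ≤-<-trans (length-preimages _≟_ h S) |S|<k
  P-step : ∀ {u z} → T (FinGraph.adj F u z) → z ∉ X → P (h u) → P (h z)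
  P-step uz z∉X Phu =
    [ (λ hz∈S → contradiction (∈-preimages⁺ _≟_ h-inj S hz∈S) z∉X) , id ]′
      (separated _ _ (h-adj _ _ uz) Phu)

module Amalgam (G : Graph) (A : List (V G)) where

  _∈A? : (v : V G) → Dec (v ∈ A)
  v ∈A? = Any.any? (≟-vertex G v) A

  _∼_ : V G ⊎ V G → V G ⊎ V G → Set
  inj₁ u ∼ inj₁ v = Adj G u v
  inj₁ u ∼ inj₂ v = Adj G u v × u ∈ A × v ∉ A
  inj₂ u ∼ inj₁ v = Adj G u v × u ∉ A × v ∈ A
  inj₂ u ∼ inj₂ v = Adj G u v × u ∉ A × v ∉ A

  ∼-sym : ∀ {x y} → x ∼ y → y ∼ x
  ∼-sym {inj₁ _} {inj₁ _} uv             = Graph.sym G uv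
  ∼-sym {inj₁ _} {inj₂ _} (uv , pu , pv) = Graph.sym G uv , pv , pu
  ∼-sym {inj₂ _} {inj₁ _} (uv , pu , pv) = Graph.sym G uv , pv , pu
  ∼-sym {inj₂ _} {inj₂ _} (uv , pu , pv) = Graph.sym G uv , pv , pu

  ∼-irrefl : ∀ {x} → ¬ x ∼ x
  ∼-irrefl {inj₁ _} uu       = Graph.irrefl G uu
  ∼-irrefl {inj₂ _} (uu , _) = Graph.irrefl G uu

  code-amalgam : V G ⊎ V G → ℕ
  code-amalgam (inj₁ v) = 2 * code G v
  code-amalgam (inj₂ v) = suc (2 * code G v)

  code-amalgam-injective : Injective _≡_ _≡_ code-amalgam
  code-amalgam-injective {inj₁ u} {inj₁ v} p =
    cong inj₁ (code-inj G (*-cancelˡ-≡ (code G u) (code G v) 2 p))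
  code-amalgam-injective {inj₁ u} {inj₂ v} p = contradiction p (even≢odd (code G u) (code G v))
  code-amalgam-injective {inj₂ u} {inj₁ v} p = contradiction (sym p) (even≢odd (code G v) (code G u))
  code-amalgam-injective {inj₂ u} {inj₂ v} p =
    cong inj₂ (code-inj G (*-cancelˡ-≡ (code G u) (code G v) 2 (suc-injective p)))

  amalgam : Graph
  amalgam = record
    { V = V G ⊎ V G ; Adj = _∼_
    ; sym = λ {x} {y} → ∼-sym {x} {y} ; irrefl = λ {x} → ∼-irrefl {x}
    ; code = code-amalgam ; code-inj = code-amalgam-injective }

  left-embedding : InducedEmbedding G amalgam
  left-embedding = inj₁ , inj₁-injective , λ _ _ → ⇔-id _

  right : V G → V G ⊎ V G
  right v with v ∈A?
  ... | yes _ = inj₁ v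
  ... | no _  = inj₂ v

  reduce-right : ∀ v → reduce (right v) ≡ v
  reduce-right v with v ∈A?
  ... | yes _ = refl
  ... | no _  = refl

  right-adj : ∀ u v → Adj G u v ⇔ (right u ∼ right v)
  right-adj u v with u ∈A? | v ∈A?
  ... | yes _   | yes _   = ⇔-id _
  ... | yes u∈A | no v∉A  = mk⇔ (_, u∈A , v∉A) proj₁
  ... | no u∉A  | yes v∈A = mk⇔ (_, u∉A , v∈A) proj₁
  ... | no u∉A  | no v∉A  = mk⇔ (_, u∉A , v∉A) proj₁

  right-embedding : InducedEmbedding G amalgam
  right-embedding =
    right ,
    (λ {u} {v} ru≡rv → trans (sym (reduce-right u)) (trans (cong reduce ru≡rv) (reduce-right v))) ,
    right-adj

  right-fixes : ∀ {a} → a ∈ A → right a ≡ inj₁ a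
  right-fixes {a} a∈A with a ∈A?
  ... | yes _   = refl
  ... | no a∉A  = contradiction a∈A a∉A

  right-new : ∀ {a} → a ∉ A → ∀ {b} → right a ≢ inj₁ b
  right-new {a} a∉A with a ∈A?
  ... | yes a∈A = contradiction a∈A a∉A
  ... | no _    = λ ()

  reduce-adj : ∀ {x y} → x ∼ y → Adj G (reduce x) (reduce y)
  reduce-adj {inj₁ _} {inj₁ _} uv       = uv
  reduce-adj {inj₁ _} {inj₂ _} (uv , _) = uv
  reduce-adj {inj₂ _} {inj₁ _} (uv , _) = uv
  reduce-adj {inj₂ _} {inj₂ _} (uv , _) = uv

  A₁ : List (V G ⊎ V G)
  A₁ = map inj₁ A

  length-A₁ : length A₁ ≡ length A
  length-A₁ = length-map inj₁ A

  LeftOnly : V G ⊎ V G → Set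
  LeftOnly (inj₁ v) = v ∉ A
  LeftOnly (inj₂ _) = ⊥

  left-separated : SeparatedBy amalgam A₁ LeftOnly
  left-separated (inj₁ _) (inj₁ v) _ _ with v ∈A?
  ... | yes v∈A = inj₁ (∈-map⁺ inj₁ v∈A)
  ... | no v∉A  = inj₂ v∉A
  left-separated (inj₁ _) (inj₂ _) (_ , u∈A , _) u∉A = contradiction u∈A u∉A

  inj₁∉A₁ : ∀ {v} → v ∉ A → inj₁ v ∉ A₁
  inj₁∉A₁ v∉A v∈A₁ with ∈-map⁻ inj₁ v∈A₁
  ... | _ , v∈A , refl = v∉A v∈A

  inj₂∉A₁ : ∀ {v} → inj₂ v ∉ A₁
  inj₂∉A₁ v∈A₁ with ∈-map⁻ inj₁ v∈A₁
  ... | _ , _ , ()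

  -- The second copy of A is only there to keep the vertex type a plain sum.
  right-copy-of-A-isolated : ∀ {a y} → a ∈ A → ¬ (inj₂ a ∼ y)
  right-copy-of-A-isolated {y = inj₁ _} a∈A (_ , a∉A , _) = a∉A a∈A
  right-copy-of-A-isolated {y = inj₂ _} a∈A (_ , a∉A , _) = a∉A a∈A

  project-subgraph : ∀ {k F} → KConnected k F → length A < k →
                     SubgraphOf F amalgam → SubgraphOf F G
  project-subgraph {k} {F} kc |A|<k (h , h-inj , h-adj) =
    reduce ∘ h , reduce∘h-injective , λ u v uv → reduce-adj {h u} {h v} (h-adj u v uv)
    where
    crossing : ∀ {u w x} → h u ≡ inj₁ x → h w ≡ inj₂ x → ⊥
    crossing {u} {w} {x} hu hw with x ∈A?
    ... | yes x∈A =
      let (z , wz) = KConnected-neighbour kc (≤-<-trans z≤n |A|<k) w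
      in right-copy-of-A-isolated {y = h z} x∈A (subst (_∼ h z) hw (h-adj w z wz))
    ... | no x∉A = subst LeftOnly hw
      (KConnected-one-side {H = amalgam} kc (h , h-inj , h-adj) A₁
        (subst (_< k) (sym length-A₁) |A|<k) left-separated u w
        (subst (_∉ A₁) (sym hu) (inj₁∉A₁ x∉A)) (subst (_∉ A₁) (sym hw) inj₂∉A₁)
        (subst LeftOnly (sym hu) x∉A))
    reduce∘h-injective : Injective _≡_ _≡_ (reduce ∘ h)
    reduce∘h-injective {u} {w} eq with h u in hu | h w in hw
    ... | inj₁ _ | inj₁ _ = h-inj (trans hu (trans (cong inj₁ eq) (sym hw)))
    ... | inj₂ _ | inj₂ _ = h-inj (trans hu (trans (cong inj₂ eq) (sym hw)))
    ... | inj₁ _ | inj₂ _ = contradiction (subst (λ x → h w ≡ inj₂ x) (sym eq) hw) (crossing hu)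
    ... | inj₂ _ | inj₁ _ = contradiction (subst (λ x → h u ≡ inj₂ x) eq hu) (crossing hw)

  amalgam-omits : ∀ {k C} → All (KConnected k) C → length A < k → Omits C G → Omits C amalgam
  amalgam-omits kcs |A|<k G-omits =
    zipWith (λ (kc , ¬F⊆G) F⊆H → ¬F⊆G (project-subgraph kc |A|<k F⊆H)) (kcs , G-omits)

∈⇒InAcl : ∀ (G : Graph) A {a} → a ∈ A → InAcl G A a
∈⇒InAcl G A {a} a∈A =
  1 , qf (eqF zero (suc zero)) , (λ _ → a) , (λ _ → a∈A) , (a ∷ [] , λ _ b≡a → here b≡a) , refl

∉⇒¬InAcl : ∀ {k C} → All (KConnected k) C → ∀ {G} → ExistentiallyComplete C G →
           ∀ {A} → length A < k → ∀ {a} → a ∉ A → ¬ InAcl G A a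
∉⇒¬InAcl kcs {G} ecG {A} |A|<k {a} a∉A (_ , φ , ps , ps∈A , (L , covers) , sat) =
  let (c , c≢L , c-sat) = ExistentiallyComplete-avoids ecG amalgam
                            (amalgam-omits kcs |A|<k (proj₁ ecG)) left-embedding
                            φ ps (lookup L) (λ _ → right-new a∉A)
                            (Sat-embed right-embedding right-fixes-ps φ sat)
      c∈L = covers c c-sat
  in c≢L (Any.index c∈L) (lookup-index c∈L)
  where
  open Amalgam G A
  right-fixes-ps : ∀ i → extend (right a) (inj₁ ∘ ps) i ≡ right (extend a ps i)
  right-fixes-ps zero    = refl
  right-fixes-ps (suc i) = sym (right-fixes (ps∈A i))

lemma6 : (k : ℕ) (C : List FinGraph) → All (KConnected k) C →
         (G : Graph) → ExistentiallyComplete C G →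
         (A : List (V G)) → length A < k →
         ∀ a → InAcl G A a ⇔ a ∈ A
lemma6 _ _ kcs G ecG A |A|<k a = mk⇔
  (λ a∈acl → decidable-stable (Any.any? (≟-vertex G a) A)
               (λ a∉A → ∉⇒¬InAcl kcs ecG |A|<k a∉A a∈acl))
  (∈⇒InAcl G A)
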